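{- Let $t\ge 0$ be an integer and let $\mathcal{P}_t=\{i\in\{2,\dots,n\}: \mathsf{LCP}[i]=t\}$. Then for any two distinct integers $i,j\in\mathcal{P}_t$, $\mathsf{LF}_{\mathsf{dist}(i)}(i)\neq\mathsf{LF}_{\mathsf{dist}(j)}(j)$.
   Context: $T$ is a string of length $n\ge 2$ over $\Sigma=\{1,\dots,\sigma\}$ whose last character is a special character $\$$ not occurring in $T[1..n-1]$, every character of $\Sigma$ occurring in $T$. $\mathsf{SA}$ is the suffix array ($T[\mathsf{SA}[1]..n]\prec\cdots\prec T[\mathsf{SA}[n]..n]$ lexicographically). The LCP array has $\mathsf{LCP}[1]=0$ and, for $i\ge 2$, $\mathsf{LCP}[i]$ is the length of the longest common prefix of $T[\mathsf{SA}[i]..n]$ and $T[\mathsf{SA}[i-1]..n]$. $\mathsf{LF}(i)$ is defined by $\mathsf{SA}[\mathsf{LF}(i)]=\mathsf{SA}[i]-1$ if $\mathsf{SA}[i]\ne 1$, and $\mathsf{SA}[\mathsf{LF}(x)]=n$ where $\mathsf{SA}[x]=1$. The BWT is $L[i]=T[\mathsf{SA}[\mathsf{LF}(i)]]$. $\mathcal{S}_{\mathsf{start}}$ is the set of starting positions of the maximal runs of equal characters in $L$, i.e. $\mathcal{S}_{\mathsf{start}}=\{1\}\cup\{i\in\{2,\dots,n\}: L[i]\neq L[i-1]\}$. $\mathsf{LF}_0(i)=i$ and $\mathsf{LF}_x(i)=\mathsf{LF}_{x-1}(\mathsf{LF}(i))$ for $x\ge1$. $\mathsf{dist}(i)=\min\{x\ge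 0: \mathsf{LF}_x(i)\in\mathcal{S}_{\mathsf{start}}\}$. -}

module Defs where

open import Data.Nat using (ℕ; zero; suc; _∸_; _≤_; _<_; _≟_)
open import Data.List using (List; []; _∷_; map)
open import Data.Product using (_×_; ∃)
open import Data.Sum using (_⊎_)
open import Relation.Binary.PropositionalEquality using (_≡_; _≢_)
open import Relation.Nullary using (¬_; yes; no)

-- Positions are 1-based natural numbers, as in the paper.

range : ℕ → ℕ → List ℕ
range a b = go (suc b ∸ a) a
  where
  go : ℕ → ℕ → List ℕ
  go zero    _ = []
  go (suc k) x = x ∷ go k (suc x)

suffix : (ℕ → ℕ) → ℕ → ℕ → List ℕ
suffix T n p = map T (range p n)

data _≺_ : List ℕ → List ℕ → Set where
  []≺   : ∀ {y ys} → [] ≺ (y ∷ ys)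
  head< : ∀ {x y xs ys} → x < y → (x ∷ xs) ≺ (y ∷ ys)
  tail≺ : ∀ {x xs ys} → xs ≺ ys → (x ∷ xs) ≺ (x ∷ ys)

lcp : List ℕ → List ℕ → ℕ
lcp []       _        = 0
lcp (_ ∷ _)  []       = 0
lcp (x ∷ xs) (y ∷ ys) with x ≟ y
... | yes _ = suc (lcp xs ys)
... | no  _ = 0

iter : (ℕ → ℕ) → ℕ → ℕ → ℕ
iter f zero    i = i
iter f (suc x) i = iter f x (f i)

-- A text T[1..n] over Σ = {1..σ} ending with a unique terminator $,
-- together with its suffix array SA and the LF mapping.
record BWTSetting (n σ : ℕ) : Set where
  field
    n≥2      : 2 ≤ n
    T        : ℕ → ℕ
    T-alph   : ∀ p → 1 ≤ p → p < n → 1 ≤ T p × T p ≤ σ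
    T-surj   : ∀ c → 1 ≤ c → c ≤ σ → ∃ λ p → 1 ≤ p × p ≤ n × T p ≡ c
    T-$      : ∀ p → 1 ≤ p → p < n → T p ≢ T n
    SA       : ℕ → ℕ
    SA-range : ∀ i → 1 ≤ i → i ≤ n → 1 ≤ SA i × SA i ≤ n
    SA-surj  : ∀ p → 1 ≤ p → p ≤ n → ∃ λ i → 1 ≤ i × i ≤ n × SA i ≡ p
    SA-sort  : ∀ i j → 1 ≤ i → i < j → j ≤ n →
               suffix T n (SA i) ≺ suffix T n (SA j)
    LF       : ℕ → ℕ
    LF-range : ∀ i → 1 ≤ i → i ≤ n → 1 ≤ LF i × LF i ≤ n
    LF-def   : ∀ i → 1 ≤ i → i ≤ n →
               (SA i ≢ 1 → SA (LF i) ≡ SA i ∸ 1) × (SA i ≡ 1 → SA (LF i) ≡ n)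

module BWT {n σ : ℕ} (S : BWTSetting n σ) where
  open BWTSetting S

  LCP : ℕ → ℕ
  LCP 1 = 0
  LCP i = lcp (suffix T n (SA i)) (suffix T n (SA (i ∸ 1)))

  L : ℕ → ℕ
  L i = T (SA (LF i))

  Sstart : ℕ → Set
  Sstart i = 1 ≤ i × i ≤ n × (i ≡ 1 ⊎ (2 ≤ i × L i ≢ L (i ∸ 1)))

  LFx : ℕ → ℕ → ℕ
  LFx x i = iter LF x i

  IsDist : ℕ → ℕ → Set
  IsDist i d = Sstart (LFx d i) × (∀ y → y < d → ¬ Sstart (LFx y i))

  InP : ℕ → ℕ → Set
  InP t i = 2 ≤ i × i ≤ n × LCP i ≡ t

-- Key fact: if row p is not a run start of L, then p-1 and p carry the same
-- BWT character c, so (in the suffix order) prepending c to the adjacent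
-- suffixes of rows p-1 and p yields adjacent suffixes again.  Hence
-- LF p = LF (p-1) + 1 and LCP (LF p) = LCP p + 1.  Iterating, along the
-- first dist(i) steps of an LF-path the LCP grows by exactly one per step,
-- so LCP (LF_{dist(i)} i) = LCP i + dist(i).  If LF_{dist(i)} i and
-- LF_{dist(j)} j coincided, the equal LCP values t would force
-- dist(i) = dist(j), and injectivity of LF (hence of LF_x) would give i = j.
module Submission where

open import Defs
open import Data.Nat using (ℕ; zero; suc; _+_; _∸_; _≤_; _<_; _≟_; z≤n; s≤s)
open import Data.Nat.Properties
open import Data.List using (List; []; _∷_; map)
open import Data.List.Properties using (∷-injective)
open import Data.Product using (_×_; _,_; proj₁; proj₂; ∃)
open import Data.Sum using (_⊎_; inj₁; inj₂)
open import Function using (_∘_)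
open import Data.Empty using (⊥; ⊥-elim)
open import Relation.Binary.PropositionalEquality
open import Relation.Binary.Definitions using (tri<; tri≈; tri>)
open import Relation.Nullary using (¬_; yes; no)

≺-irrefl : ∀ {xs} → ¬ (xs ≺ xs)
≺-irrefl (head< x<x) = <-irrefl refl x<x
≺-irrefl (tail≺ p)   = ≺-irrefl p

≺-trans : ∀ {xs ys zs} → xs ≺ ys → ys ≺ zs → xs ≺ zs
≺-trans []≺       (head< _) = []≺
≺-trans []≺       (tail≺ _) = []≺
≺-trans (head< a) (head< b) = head< (<-trans a b)
≺-trans (head< a) (tail≺ _) = head< a
≺-trans (tail≺ _) (head< b) = head< b
≺-trans (tail≺ a) (tail≺ b) = tail≺ (≺-trans a b)

≺-between-cons : ∀ {c X Y W} → (c ∷ X) ≺ W → W ≺ (c ∷ Y) →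
                 ∃ λ Z → W ≡ c ∷ Z × X ≺ Z × Z ≺ Y
≺-between-cons (head< a) (head< b) = ⊥-elim (<-asym a b)
≺-between-cons (head< a) (tail≺ _) = ⊥-elim (<-irrefl refl a)
≺-between-cons (tail≺ a) (head< b) = ⊥-elim (<-irrefl refl b)
≺-between-cons (tail≺ {ys = Z} a) (tail≺ b) = Z , refl , a , b

lcp-cons : ∀ c X Y → lcp (c ∷ X) (c ∷ Y) ≡ suc (lcp X Y)
lcp-cons c X Y with c ≟ c
... | yes _ = refl
... | no c≢c = ⊥-elim (c≢c refl)

iter-suc : ∀ f x i → iter f (suc x) i ≡ f (iter f x i)
iter-suc f zero    i = refl
iter-suc f (suc x) i = iter-suc f x (f i)

range-cons : ∀ s n → s ≤ n → range s n ≡ s ∷ range (suc s) n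
range-cons s n s≤n with suc n ∸ s | +-∸-assoc 1 s≤n
... | .(suc (n ∸ s)) | refl = refl

range-past-end : ∀ n → range (suc n) n ≡ []
range-past-end n with n ∸ n | n∸n≡0 n
... | .0 | refl = refl

suffix-cons : ∀ T n s → s ≤ n → suffix T n s ≡ T s ∷ suffix T n (suc s)
suffix-cons T n s s≤n = cong (map T) (range-cons s n s≤n)

suffix-past-end : ∀ T n → suffix T n (suc n) ≡ []
suffix-past-end T n = cong (map T) (range-past-end n)

module LFProperties {n σ} (S : BWTSetting n σ) where
  open BWTSetting S
  open BWT S

  suf : ℕ → List ℕ
  suf = suffix T n

  SA-reflects : ∀ a b → 1 ≤ a → a ≤ n → 1 ≤ b → b ≤ n →
                suf (SA a) ≺ suf (SA b) → a < b
  SA-reflects a b a≥1 a≤n b≥1 b≤n lt with <-cmp a b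
  ... | tri< a<b _ _ = a<b
  ... | tri≈ _ refl _ = ⊥-elim (≺-irrefl lt)
  ... | tri> _ _ b<a = ⊥-elim (≺-irrefl (≺-trans lt (SA-sort b a b≥1 b<a a≤n)))

  SA-injective : ∀ a b → 1 ≤ a → a ≤ n → 1 ≤ b → b ≤ n → SA a ≡ SA b → a ≡ b
  SA-injective a b a≥1 a≤n b≥1 b≤n eq with <-cmp a b
  ... | tri< a<b _ _ = ⊥-elim (≺-irrefl (subst (λ z → suf (SA a) ≺ suf z) (sym eq) (SA-sort a b a≥1 a<b b≤n)))
  ... | tri≈ _ a≡b _ = a≡b
  ... | tri> _ _ b<a = ⊥-elim (≺-irrefl (subst (λ z → suf (SA b) ≺ suf z) eq (SA-sort b a b≥1 b<a a≤n)))

  SA-LF-suc : ∀ a → 1 ≤ a → a ≤ n → SA a ≢ 1 → SA a ≡ suc (SA (LF a))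
  SA-LF-suc a a≥1 a≤n SAa≢1 =
    trans (+-∸-assoc 1 (proj₁ (SA-range a a≥1 a≤n)))
          (cong suc (sym (proj₁ (LF-def a a≥1 a≤n) SAa≢1)))

  -- Row of the whole text and a row of a proper suffix never share their LF:
  -- the former goes to the row of T[n..n], the latter to a suffix starting < n.
  LF-whole≢LF-proper : ∀ a b → 1 ≤ a → a ≤ n → 1 ≤ b → b ≤ n →
                       SA a ≡ 1 → SA b ≢ 1 → LF a ≢ LF b
  LF-whole≢LF-proper a b a≥1 a≤n b≥1 b≤n SAa≡1 SAb≢1 eq =
    1+n≰n (≤-trans (≤-reflexive suc-n≡SAb) (proj₂ (SA-range b b≥1 b≤n)))
    where
    open ≡-Reasoning
    suc-n≡SAb : suc n ≡ SA b
    suc-n≡SAb = begin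
      suc n           ≡⟨ cong suc (sym (proj₂ (LF-def a a≥1 a≤n) SAa≡1)) ⟩
      suc (SA (LF a)) ≡⟨ cong (λ r → suc (SA r)) eq ⟩
      suc (SA (LF b)) ≡⟨ sym (SA-LF-suc b b≥1 b≤n SAb≢1) ⟩
      SA b            ∎

  -- LF is injective on the rows: both cases reduce to injectivity of SA.
  LF-injective : ∀ a b → 1 ≤ a → a ≤ n → 1 ≤ b → b ≤ n → LF a ≡ LF b → a ≡ b
  LF-injective a b a≥1 a≤n b≥1 b≤n eq with SA a ≟ 1 | SA b ≟ 1
  ... | yes SAa≡1 | yes SAb≡1 = SA-injective a b a≥1 a≤n b≥1 b≤n (trans SAa≡1 (sym SAb≡1))
  ... | yes SAa≡1 | no SAb≢1 = ⊥-elim (LF-whole≢LF-proper a b a≥1 a≤n b≥1 b≤n SAa≡1 SAb≢1 eq)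
  ... | no SAa≢1 | yes SAb≡1 = ⊥-elim (LF-whole≢LF-proper b a b≥1 b≤n a≥1 a≤n SAb≡1 SAa≢1 (sym eq))
  ... | no SAa≢1 | no SAb≢1 = SA-injective a b a≥1 a≤n b≥1 b≤n
      (trans (SA-LF-suc a a≥1 a≤n SAa≢1)
        (trans (cong (λ r → suc (SA r)) eq) (sym (SA-LF-suc b b≥1 b≤n SAb≢1))))

  LFx-range : ∀ x i → 1 ≤ i → i ≤ n → 1 ≤ LFx x i × LFx x i ≤ n
  LFx-range zero    i i≥1 i≤n = i≥1 , i≤n
  LFx-range (suc x) i i≥1 i≤n = LFx-range x (LF i) (proj₁ (LF-range i i≥1 i≤n)) (proj₂ (LF-range i i≥1 i≤n))

  LFx-injective : ∀ x a b → 1 ≤ a → a ≤ n → 1 ≤ b → b ≤ n → LFx x a ≡ LFx x b → a ≡ b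
  LFx-injective zero    a b _ _ _ _ eq = eq
  LFx-injective (suc x) a b a≥1 a≤n b≥1 b≤n eq =
    LF-injective a b a≥1 a≤n b≥1 b≤n
      (LFx-injective x (LF a) (LF b) (proj₁ (LF-range a a≥1 a≤n)) (proj₂ (LF-range a a≥1 a≤n))
        (proj₁ (LF-range b b≥1 b≤n)) (proj₂ (LF-range b b≥1 b≤n)) eq)

  L≡$⇒SA≡1 : ∀ b → 1 ≤ b → b ≤ n → L b ≡ T n → SA b ≡ 1
  L≡$⇒SA≡1 b b≥1 b≤n Lb≡$ with SA b ≟ 1
  ... | yes SAb≡1 = SAb≡1
  ... | no SAb≢1 = ⊥-elim (T-$ (SA (LF b)) SALFb≥1 SALFb<n Lb≡$)
    where
    SALFb≥1 : 1 ≤ SA (LF b)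
    SALFb≥1 = proj₁ (SA-range (LF b) (proj₁ (LF-range b b≥1 b≤n)) (proj₂ (LF-range b b≥1 b≤n)))
    SALFb<n : SA (LF b) < n
    SALFb<n = ≤-trans (≤-reflexive (sym (SA-LF-suc b b≥1 b≤n SAb≢1))) (proj₂ (SA-range b b≥1 b≤n))

  L-shared⇒SA≢1 : ∀ a b → 1 ≤ a → a ≤ n → 1 ≤ b → b ≤ n →
                  a ≢ b → L a ≡ L b → SA a ≢ 1
  L-shared⇒SA≢1 a b a≥1 a≤n b≥1 b≤n a≢b La≡Lb SAa≡1 =
    a≢b (SA-injective a b a≥1 a≤n b≥1 b≤n (trans SAa≡1 (sym SAb≡1)))
    where
    La≡$ : L a ≡ T n
    La≡$ = cong T (proj₂ (LF-def a a≥1 a≤n) SAa≡1)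
    SAb≡1 : SA b ≡ 1
    SAb≡1 = L≡$⇒SA≡1 b b≥1 b≤n (trans (sym La≡Lb) La≡$)

  suf-LF : ∀ a → 1 ≤ a → a ≤ n → SA a ≢ 1 → suf (SA (LF a)) ≡ L a ∷ suf (SA a)
  suf-LF a a≥1 a≤n SAa≢1 =
    trans (suffix-cons T n (SA (LF a)) SALFa≤n)
          (cong (λ s → L a ∷ suf s) (sym (SA-LF-suc a a≥1 a≤n SAa≢1)))
    where
    SALFa≤n : SA (LF a) ≤ n
    SALFa≤n = proj₂ (SA-range (LF a) (proj₁ (LF-range a a≥1 a≤n)) (proj₂ (LF-range a a≥1 a≤n)))

  suf-LF-run : ∀ q → 1 ≤ q → suc q ≤ n → L (suc q) ≡ L q →
               suf (SA (LF (suc q))) ≡ L (suc q) ∷ suf (SA (suc q)) ×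
               suf (SA (LF q)) ≡ L (suc q) ∷ suf (SA q)
  suf-LF-run q q≥1 q<n same =
    suf-LF (suc q) p≥1 q<n (L-shared⇒SA≢1 (suc q) q p≥1 q<n q≥1 q≤n 1+n≢n same) ,
    trans (suf-LF q q≥1 q≤n (L-shared⇒SA≢1 q (suc q) q≥1 q≤n p≥1 q<n (1+n≢n ∘ sym) (sym same)))
          (cong (_∷ suf (SA q)) (sym same))
    where
    p≥1 : 1 ≤ suc q
    p≥1 = s≤s z≤n
    q≤n : q ≤ n
    q≤n = <⇒≤ q<n

  no-suffix-between : ∀ a s → 1 ≤ a → suc a ≤ n → 1 ≤ s → s ≤ suc n →
                      suf (SA a) ≺ suf s → suf s ≺ suf (SA (suc a)) → ⊥
  no-suffix-between a s a≥1 a<n s≥1 s≤1+n lo hi with m≤n⇒m<n∨m≡n s≤1+n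
  ... | inj₂ refl = below-empty (subst (suf (SA a) ≺_) (suffix-past-end T n) lo)
    where
    below-empty : ∀ {X} → ¬ (X ≺ [])
    below-empty ()
  ... | inj₁ (s≤s s≤n) with SA-surj s s≥1 s≤n
  ... | r , r≥1 , r≤n , SAr≡s = <-irrefl refl (≤-trans (s≤s a<r) r<1+a)
    where
    a<r : a < r
    a<r = SA-reflects a r a≥1 (<⇒≤ a<n) r≥1 r≤n (subst (λ z → suf (SA a) ≺ suf z) (sym SAr≡s) lo)
    r<1+a : r < suc a
    r<1+a = SA-reflects r (suc a) r≥1 r≤n (s≤s z≤n) a<n (subst (λ z → suf z ≺ suf (SA (suc a))) (sym SAr≡s) hi)

  no-suffix-between-cons : ∀ a r c → 1 ≤ a → suc a ≤ n → 1 ≤ r → r ≤ n →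
                           (c ∷ suf (SA a)) ≺ suf (SA r) →
                           suf (SA r) ≺ (c ∷ suf (SA (suc a))) → ⊥
  no-suffix-between-cons a r c a≥1 a<n r≥1 r≤n lo hi with ≺-between-cons lo hi
  ... | Z , sufw≡c∷Z , lo′ , hi′ =
    no-suffix-between a (suc w) a≥1 a<n (s≤s z≤n) (s≤s w≤n)
      (subst (suf (SA a) ≺_) Z≡tail lo′) (subst (_≺ suf (SA (suc a))) Z≡tail hi′)
    where
    w : ℕ
    w = SA r
    w≤n : w ≤ n
    w≤n = proj₂ (SA-range r r≥1 r≤n)
    Z≡tail : Z ≡ suf (suc w)
    Z≡tail = proj₂ (∷-injective (trans (sym sufw≡c∷Z) (suffix-cons T n w w≤n)))

  LF-run-adjacent : ∀ q → 1 ≤ q → suc q ≤ n → L (suc q) ≡ L q → LF (suc q) ≡ suc (LF q)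
  LF-run-adjacent q q≥1 q<n same = adjacent (m≤n⇒m<n∨m≡n LFq<LFp)
    where
    p c : ℕ
    p = suc q
    c = L p
    p≥1 : 1 ≤ p
    p≥1 = s≤s z≤n
    q≤n : q ≤ n
    q≤n = <⇒≤ q<n
    LFp≥1 : 1 ≤ LF p
    LFp≥1 = proj₁ (LF-range p p≥1 q<n)
    LFp≤n : LF p ≤ n
    LFp≤n = proj₂ (LF-range p p≥1 q<n)
    LFq≥1 : 1 ≤ LF q
    LFq≥1 = proj₁ (LF-range q q≥1 q≤n)
    LFq≤n : LF q ≤ n
    LFq≤n = proj₂ (LF-range q q≥1 q≤n)
    suf-LFp : suf (SA (LF p)) ≡ c ∷ suf (SA p)
    suf-LFp = proj₁ (suf-LF-run q q≥1 q<n same)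
    suf-LFq : suf (SA (LF q)) ≡ c ∷ suf (SA q)
    suf-LFq = proj₂ (suf-LF-run q q≥1 q<n same)
    LFq<LFp : LF q < LF p
    LFq<LFp = SA-reflects (LF q) (LF p) LFq≥1 LFq≤n LFp≥1 LFp≤n
                (subst₂ _≺_ (sym suf-LFq) (sym suf-LFp) (tail≺ (SA-sort q p q≥1 ≤-refl q<n)))
    adjacent : suc (LF q) < LF p ⊎ suc (LF q) ≡ LF p → LF p ≡ suc (LF q)
    adjacent (inj₂ eq) = sym eq
    adjacent (inj₁ r<LFp) = ⊥-elim (no-suffix-between-cons q r c q≥1 q<n (s≤s z≤n) r≤n
        (subst (_≺ suf (SA r)) suf-LFq (SA-sort (LF q) r LFq≥1 ≤-refl r≤n))
        (subst (suf (SA r) ≺_) suf-LFp (SA-sort r (LF p) (s≤s z≤n) r<LFp LFp≤n)))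
      where
      r : ℕ
      r = suc (LF q)
      r≤n : r ≤ n
      r≤n = ≤-trans (<⇒≤ r<LFp) LFp≤n

  LCP-suc : ∀ q → 1 ≤ q → LCP (suc q) ≡ lcp (suf (SA (suc q))) (suf (SA q))
  LCP-suc (suc _) _ = refl

  LCP-run-step : ∀ q → 1 ≤ q → suc q ≤ n → L (suc q) ≡ L q →
                 LCP (LF (suc q)) ≡ suc (LCP (suc q))
  LCP-run-step q q≥1 q<n same = begin
      LCP (LF p)
    ≡⟨ cong LCP adjacent ⟩
      LCP (suc (LF q))
    ≡⟨ LCP-suc (LF q) (proj₁ (LF-range q q≥1 q≤n)) ⟩
      lcp (suf (SA (suc (LF q)))) (suf (SA (LF q)))
    ≡⟨ cong (λ r → lcp (suf (SA r)) (suf (SA (LF q)))) (sym adjacent) ⟩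
      lcp (suf (SA (LF p))) (suf (SA (LF q)))
    ≡⟨ cong₂ lcp suf-LFp suf-LFq ⟩
      lcp (L p ∷ suf (SA p)) (L p ∷ suf (SA q))
    ≡⟨ lcp-cons (L p) (suf (SA p)) (suf (SA q)) ⟩
      suc (lcp (suf (SA p)) (suf (SA q)))
    ≡⟨ cong suc (sym (LCP-suc q q≥1)) ⟩
      suc (LCP p)
    ∎
    where
    open ≡-Reasoning
    p : ℕ
    p = suc q
    q≤n : q ≤ n
    q≤n = <⇒≤ q<n
    adjacent : LF p ≡ suc (LF q)
    adjacent = LF-run-adjacent q q≥1 q<n same
    suf-LFp : suf (SA (LF p)) ≡ L p ∷ suf (SA p)
    suf-LFp = proj₁ (suf-LF-run q q≥1 q<n same)
    suf-LFq : suf (SA (LF q)) ≡ L p ∷ suf (SA q)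
    suf-LFq = proj₂ (suf-LF-run q q≥1 q<n same)

  LCP-LF-non-start : ∀ p → 1 ≤ p → p ≤ n → ¬ Sstart p → LCP (LF p) ≡ suc (LCP p)
  LCP-LF-non-start (suc zero) p≥1 p≤n not-start = ⊥-elim (not-start (p≥1 , p≤n , inj₁ refl))
  LCP-LF-non-start (suc (suc m)) p≥1 p≤n not-start with L (suc (suc m)) ≟ L (suc m)
  ... | yes same = LCP-run-step (suc m) (s≤s z≤n) p≤n same
  ... | no differ = ⊥-elim (not-start (p≥1 , p≤n , inj₂ (s≤s (s≤s z≤n) , differ)))

  LCP-LFx : ∀ x i → 1 ≤ i → i ≤ n → (∀ y → y < x → ¬ Sstart (LFx y i)) →
            LCP (LFx x i) ≡ LCP i + x
  LCP-LFx zero    i _   _   _        = sym (+-identityʳ (LCP i))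
  LCP-LFx (suc x) i i≥1 i≤n no-start = begin
      LCP (LFx (suc x) i)
    ≡⟨ cong LCP (iter-suc LF x i) ⟩
      LCP (LF (LFx x i))
    ≡⟨ LCP-LF-non-start (LFx x i) (proj₁ (LFx-range x i i≥1 i≤n)) (proj₂ (LFx-range x i i≥1 i≤n))
                        (no-start x (n<1+n x)) ⟩
      suc (LCP (LFx x i))
    ≡⟨ cong suc (LCP-LFx x i i≥1 i≤n (λ y y<x → no-start y (m<n⇒m<1+n y<x))) ⟩
      suc (LCP i + x)
    ≡⟨ sym (+-suc (LCP i) x) ⟩
      LCP i + suc x
    ∎
    where open ≡-Reasoning

lemma4 : ∀ {n σ} (S : BWTSetting n σ) (t i j : ℕ) →
    BWT.InP S t i → BWT.InP S t j → i ≢ j →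
    ∀ di dj → BWT.IsDist S i di → BWT.IsDist S j dj →
    BWT.LFx S di i ≢ BWT.LFx S dj j
lemma4 S t i j (i≥2 , i≤n , LCPi≡t) (j≥2 , j≤n , LCPj≡t) i≢j di dj
       (_ , before-i) (_ , before-j) same-end =
  i≢j (LFx-injective di i j (<⇒≤ i≥2) i≤n (<⇒≤ j≥2) j≤n
        (trans same-end (cong (λ d → LFx d j) (sym di≡dj))))
  where
  open BWT S
  open LFProperties S
  open ≡-Reasoning
  di≡dj : di ≡ dj
  di≡dj = +-cancelˡ-≡ t di dj (begin
      t + di            ≡⟨ cong (_+ di) (sym LCPi≡t) ⟩
      LCP i + di        ≡⟨ sym (LCP-LFx di i (<⇒≤ i≥2) i≤n before-i) ⟩
      LCP (LFx di i)    ≡⟨ cong LCP same-end ⟩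
      LCP (LFx dj j)    ≡⟨ LCP-LFx dj j (<⇒≤ j≥2) j≤n before-j ⟩
      LCP j + dj        ≡⟨ cong (_+ dj) LCPj≡t ⟩
      t + dj            ∎)
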